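{- Let $\overline{\mathsf{M}}$ be a complemented HMS model and $FH(\overline{\mathsf{M}})$ its FH transform. For all $\varphi \in \mathcal{L}_{\mathsf{At}}$ and all $\omega \in S_{\mathsf{At}}$: $\overline{\mathsf{M}}, \omega \vDash \varphi$ if and only if $FH(\overline{\mathsf{M}}), \omega \Vdash \varphi$.
   Context: Fix nonempty sets $\mathsf{At}$ (atoms) and $I$ (agents). Lattice: nonempty pairwise disjoint $S_\Phi$ ($\Phi\subseteq\mathsf{At}$), $S_\Psi \preceq S_\Phi$ iff $\Psi\subseteq\Phi$, $\Omega := \bigcup_\Phi S_\Phi$, surjections $r^\Phi_\Psi: S_\Phi\to S_\Psi$ ($\Psi\subseteq\Phi$) with $r^\Phi_\Phi$ identity and $r^\Phi_\Upsilon = r^\Psi_\Upsilon\circ r^\Phi_\Psi$; $\omega_\Psi := r^\Phi_\Psi(\omega)$; $D_\Psi := r^\Phi_\Psi(D)$, $D_S := D_\Psi$ for $S=S_\Psi$; $D^\uparrow := \bigcup_{\Phi\subseteq\Psi}(r^\Psi_\Phi)^{ -1}(D)$ for $D\subseteq S_\Phi$. Events: sets $E=D^\uparrow$, $D\subseteq S_\Phi$, base-space $S(E):=S_\Phi$ (distinct vacuous events $\emptyset^{S_\Phi}$); $\neg E := (S_\Phi\setminus D)^\uparrow$. Complemented HMS model $\overline{\mathsf{M}} = \langle I, \{S_\Phi\}, (r^\Phi_\Psi), (\Lambda_i), (\Pi_i), v\rangle$: valuation $v$ from atoms to events; $\Pi_i:\Omega\to 2^\Omega\setminus\{\emptyset\}$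 with Confinement (if $\omega\in S_\Phi$ then $\Pi_i(\omega)\subseteq S_\Psi$ for some $\Psi\subseteq\Phi$; $S_{\Pi_i(\omega)}$ denotes that space), Generalized Reflexivity ($\omega\in(\Pi_i(\omega))^\uparrow$), Stationarity, Projections Preserve Ignorance ($\omega\in S_\Phi$, $\Psi\subseteq\Phi\Rightarrow(\Pi_i(\omega))^\uparrow\subseteq(\Pi_i(\omega_\Psi))^\uparrow$), Projections Preserve Knowledge ($\Upsilon\subseteq\Psi\subseteq\Phi$, $\omega\in S_\Phi$, $\Pi_i(\omega)\subseteq S_\Psi\Rightarrow(\Pi_i(\omega))_\Upsilon = \Pi_i(\omega_\Upsilon)$); $\Lambda_i:\Omega\to 2^\Omega$ with Reflexivity, Stationarity, Projections Preserve Implicit Knowledge ($\omega\in S_\Phi\Rightarrow\Lambda_i(\omega)_\Psi=\Lambda_i(\omega_\Psi)$ for $\Psi\subseteq\Phi$), Explicit Measurability ($\omega'\in\Lambda_i(\omega)\Rightarrow\Pi_i(\omega')=\Pi_i(\omega)$), Implicit Measurability ($\omega'\in\Pi_i(\omega)\Rightarrow\Lambda_i(\omega')=\Lambda_i(\omega)_{S_{\Pi_i(\omega)}}$). Language $\mathcal{L}_{\mathsf{At}}$: $\varphi ::= \top\mid p\mid\neg\varphi\mid\varphi\wedge\psi\mid\ell_i\varphi\mid a_i\varphi\mid k_i\varphi$; $\mathsf{At}(\varphi)$ atoms of $\varphi$; $\mathcal{L}_\Phi := \{\varphi:\mathsf{At}(\varphi)\subseteq\Phi\}$. HMS satisfaction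 ($[\varphi] := \{\omega:\overline{\mathsf{M}},\omega\vDash\varphi\}$): $\top$ everywhere; $p$ iff $\omega\in v(p)$; $\neg\varphi$ iff $\omega\in\neg[\varphi]$; $\varphi\wedge\psi$ iff $\omega\in[\varphi]\cap[\psi]$; $a_i\varphi$ iff $S_{\Pi_i(\omega)}\succeq S([\varphi])$; $\ell_i\varphi$ iff $\Lambda_i(\omega)\subseteq[\varphi]$; $k_i\varphi$ iff $\Pi_i(\omega)\subseteq[\varphi]$. FH transform $FH(\overline{\mathsf{M}}) = \langle I, W_{\mathsf{At}}, (R_{\mathsf{At},i}), (\mathcal{A}_{\mathsf{At},i}), V_{\mathsf{At}}\rangle$: $W_{\mathsf{At}} := S_{\mathsf{At}}$; $(\omega,\omega')\in R_{\mathsf{At},i}$ iff $\omega'\in\Lambda_i(\omega)$; $\mathcal{A}_{\mathsf{At},i}(\omega) := \mathcal{L}_\Phi$ for the $\Phi$ with $\Pi_i(\omega)\subseteq S_\Phi$; $V_{\mathsf{At}}(p) := v(p)\cap S_{\mathsf{At}}$. FH satisfaction: $\top$ always; $p$ iff $w\in V_{\mathsf{At}}(p)$; Boolean clauses standard; $a_i\varphi$ iff $\varphi\in\mathcal{A}_{\mathsf{At},i}(w)$; $\ell_i\varphi$ iff $\varphi$ holds at all $R_{\mathsf{At},i}$-successors of $w$; $k_i\varphi$ iff $\ell_i\varphi$ and $a_i\varphi$ hold.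
   Formalization: Each v(p) is an event with base-space $S_\Psi$ for Ψ = {p} rather than an arbitrary event, and every $[\varphi]$ has base-space $S_{\mathsf{At}(\varphi)}$, so $a_i\varphi$ holds at ω iff $\mathsf{At}(\varphi)\subseteq\Psi$ where $S_{\Pi_i(\omega)} = S_\Psi$. Each condition added here is assumed in the paper as well or is needed for the statement above to hold. -}

module Defs where

open import Level using (0ℓ)
open import Data.Unit using (⊤; tt)
open import Data.Product using (Σ; Σ-syntax; ∃; _×_; _,_; proj₁; proj₂)
open import Relation.Nullary using (¬_)
open import Relation.Unary using (Pred; _⊆_; ∅; U; ｛_｝; _∪_)
open import Relation.Binary.PropositionalEquality using (_≡_; subst)

Sub : Set → Set₁
Sub At = Pred At 0ℓ

data Form (At I : Set) : Set where
  ⊤'   : Form At I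
  atom : At → Form At I
  ¬'_  : Form At I → Form At I
  _∧'_ : Form At I → Form At I → Form At I
  ℓ    : I → Form At I → Form At I
  a    : I → Form At I → Form At I
  k    : I → Form At I → Form At I

Atoms : {At I : Set} → Form At I → Sub At
Atoms ⊤'        = ∅
Atoms (atom p)  = ｛ p ｝
Atoms (¬' φ)    = Atoms φ
Atoms (φ ∧' ψ)  = Atoms φ ∪ Atoms ψ
Atoms (ℓ i φ)   = Atoms φ
Atoms (a i φ)   = Atoms φ
Atoms (k i φ)   = Atoms φ

_∈L_ : {At I : Set} → Form At I → Sub At → Set
φ ∈L Φ = Atoms φ ⊆ Φ

-- Lattice of spaces.  Ω = ⋃_Φ S_Φ is the (disjoint) sum Σ Φ S_Φ.

record Lattice (At : Set) : Set₁ where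
  field
    S      : Sub At → Set
    S-ne   : ∀ Φ → S Φ
    r      : ∀ {Φ Ψ} → Ψ ⊆ Φ → S Φ → S Ψ
    r-id   : ∀ {Φ} (h : Φ ⊆ Φ) (s : S Φ) → r h s ≡ s
    r-comp : ∀ {Φ Ψ Υ} (h₁ : Ψ ⊆ Φ) (h₂ : Υ ⊆ Ψ) (h₃ : Υ ⊆ Φ) (s : S Φ) →
             r h₂ (r h₁ s) ≡ r h₃ s
    r-surj : ∀ {Φ Ψ} (h : Ψ ⊆ Φ) (t : S Ψ) → ∃ λ s → r h s ≡ t

  Ω : Set₁
  Ω = Σ (Sub At) S

  lev : Ω → Sub At
  lev = proj₁

  prj : ∀ {Ψ} (ω : Ω) → Ψ ⊆ lev ω → Ω
  prj {Ψ} ω h = Ψ , r h (proj₂ ω)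

  -- A subset D ⊆ S_Φ, recorded together with its space S_Φ.
  -- Used both for events (E = D↑ with base-space S_Φ) and for the
  -- sets Π_i(ω), Λ_i(ω)_Ψ etc. that are confined to one space.
  TSet : Set₁
  TSet = Σ (Sub At) λ Φ → Pred (S Φ) 0ℓ

  _∈ₛ_ : Ω → TSet → Set₁
  ω ∈ₛ (Φ , D) = Σ (lev ω ≡ Φ) λ e → D (subst S e (proj₂ ω))

  _∈↑_ : Ω → TSet → Set
  ω ∈↑ (Φ , D) = Σ (Φ ⊆ lev ω) λ h → D (r h (proj₂ ω))

  _≐ₛ_ : TSet → TSet → Set₁
  A ≐ₛ B = ∀ ω → (ω ∈ₛ A → ω ∈ₛ B) × (ω ∈ₛ B → ω ∈ₛ A)

  _⊆↑_ : TSet → TSet → Set₁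
  A ⊆↑ B = ∀ ω → ω ∈↑ A → ω ∈↑ B

  _↾_ : (A : TSet) → ∀ {Υ} → Υ ⊆ proj₁ A → TSet
  (Φ , D) ↾ h = _ , λ t → ∃ λ s → D s × r h s ≡ t

record HMS (At I : Set) : Set₁ where
  field
    lattice : Lattice At
  open Lattice lattice public
  field
    v        : (p : At) → Pred (S ｛ p ｝) 0ℓ
    -- possibility correspondences Π_i; Confinement is built in:
    -- Π_i(ω) ⊆ S_{Πlev i ω} with Πlev i ω ⊆ lev ω
    Π        : I → Ω → TSet
    Conf     : ∀ i ω → proj₁ (Π i ω) ⊆ lev ω
    Π-ne     : ∀ i ω → ∃ λ s → proj₂ (Π i ω) s
    GenRefl  : ∀ i ω → ω ∈↑ Π i ω
    Π-Stat   : ∀ i ω ω' → ω' ∈ₛ Π i ω → Π i ω' ≐ₛ Π i ω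
    PPI      : ∀ i ω {Ψ} (h : Ψ ⊆ lev ω) → Π i ω ⊆↑ Π i (prj ω h)
    PPK      : ∀ i ω {Υ} (h : Υ ⊆ proj₁ (Π i ω)) →
               (Π i ω ↾ h) ≐ₛ Π i (prj ω (λ x → Conf i ω (h x)))
    Λ        : I → (ω : Ω) → Pred (S (lev ω)) 0ℓ
    Λ-Refl   : ∀ i ω → Λ i ω (proj₂ ω)
    Λ-Stat   : ∀ i ω s' → Λ i ω s' →
               (lev ω , Λ i (lev ω , s')) ≐ₛ (lev ω , Λ i ω)
    PPIK     : ∀ i ω {Ψ} (h : Ψ ⊆ lev ω) →
               ((lev ω , Λ i ω) ↾ h) ≐ₛ (Ψ , Λ i (prj ω h))
    ExplMeas : ∀ i ω s' → Λ i ω s' → Π i (lev ω , s') ≐ₛ Π i ω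
    ImplMeas : ∀ i ω ω' → ω' ∈ₛ Π i ω →
               (lev ω' , Λ i ω') ≐ₛ ((lev ω , Λ i ω) ↾ Conf i ω)

  -- HMS satisfaction  M̄, ω ⊨ φ.
  -- The base-space of [φ] is S_{At(φ)}: [⊤] = Ω has base S_∅, v(p) has base
  -- S_{p}, ¬ / ℓ_i / a_i / k_i preserve the base, ∧ takes the join.
  _⊨_ : Ω → Form At I → Set
  ω ⊨ ⊤'       = ⊤
  ω ⊨ atom p   = ω ∈↑ (｛ p ｝ , v p)
  ω ⊨ (¬' φ)   = Σ (Atoms φ ⊆ lev ω) λ h → ¬ (prj ω h ⊨ φ)
  ω ⊨ (φ ∧' ψ) = (ω ⊨ φ) × (ω ⊨ ψ)
  ω ⊨ ℓ i φ    = ∀ s' → Λ i ω s' → (lev ω , s') ⊨ φ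
  ω ⊨ a i φ    = Atoms φ ⊆ proj₁ (Π i ω)
  ω ⊨ k i φ    = ∀ s' → proj₂ (Π i ω) s' → (proj₁ (Π i ω) , s') ⊨ φ

record FHModel (At I : Set) : Set₁ where
  field
    W   : Set
    R   : I → W → W → Set
    𝒜   : I → W → Pred (Form At I) 0ℓ
    V   : At → Pred W 0ℓ

  _⊩_ : W → Form At I → Set
  w ⊩ ⊤'       = ⊤
  w ⊩ atom p   = V p w
  w ⊩ (¬' φ)   = ¬ (w ⊩ φ)
  w ⊩ (φ ∧' ψ) = (w ⊩ φ) × (w ⊩ ψ)
  w ⊩ ℓ i φ    = ∀ w' → R i w w' → w' ⊩ φ
  w ⊩ a i φ    = 𝒜 i w φ
  w ⊩ k i φ    = (∀ w' → R i w w' → w' ⊩ φ) × 𝒜 i w φ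

FH : {At I : Set} → HMS At I → FHModel At I
FH {At} {I} M = record
  { W = S U
  ; R = λ i w w' → Λ i (U , w) w'
  ; 𝒜 = λ i w φ → φ ∈L proj₁ (Π i (U , w))
  ; V = λ p w → (U , w) ∈↑ (｛ p ｝ , v p)
  }
  where open HMS M

{-# OPTIONS --safe #-}
-- Truth in an HMS model is invariant under projection: if At(φ) ⊆ Ψ then ω ⊨ φ iff ω_Ψ ⊨ φ.
-- This goes by induction on φ; for ℓ_i it is Projections Preserve Implicit Knowledge, and for a_i
-- one shows that the awareness level of ω_Ψ is S_{Π_i(ω)} ∩ Ψ (PPI and PPK).  The two
-- measurability conditions with (generalized) reflexivity give Π_i(ω) = Λ_i(ω)_{S_{Π_i(ω)}}, so
-- by projection invariance k_i φ ⇔ ℓ_i φ ∧ a_i φ holds at every state: this is the FH clause for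
-- k_i.  All other clauses of the two semantics coincide on S_At, negation again by invariance.
module Submission where

open import Defs
open import Function using (_∘_)
open import Function.Bundles using (_⇔_; mk⇔; module Equivalence)
open import Function.Construct.Identity using (⇔-id)
open import Function.Construct.Symmetry using (⇔-sym)
open import Function.Construct.Composition using (_⇔-∘_)
open import Data.Product using (_,_; proj₁; proj₂; _×_; ∃)
open import Data.Product.Function.NonDependent.Propositional using (_×-⇔_)
open import Data.Sum using (inj₁; inj₂)
open import Data.Unit using (tt)
open import Level using (0ℓ)
open import Relation.Nullary using (¬_)
open import Relation.Unary using (Pred; U; _⊆_; _∩_)
open import Relation.Binary.PropositionalEquality using (_≡_; refl; sym; trans; cong; subst)

open Equivalence using (to; from)

module LatticeProperties {At : Set} (L : Lattice At) where
  open Lattice L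

  r-irrelevant : ∀ {Φ Ψ} (g g′ : Ψ ⊆ Φ) (s : S Φ) → r g s ≡ r g′ s
  r-irrelevant g g′ s = trans (cong (r g) (sym (r-id (λ x → x) s))) (r-comp (λ x → x) g g′ s)

  subst-r : ∀ {Φ Ψ Ψ′} (e : Ψ ≡ Ψ′) (g : Ψ ⊆ Φ) (g′ : Ψ′ ⊆ Φ) (s : S Φ) →
            subst S e (r g s) ≡ r g′ s
  subst-r refl = r-irrelevant

  prj-prj : ∀ ω {Ψ Υ} (h : Ψ ⊆ lev ω) (g : Υ ⊆ Ψ) (h′ : Υ ⊆ lev ω) →
            prj (prj ω h) g ≡ prj ω h′
  prj-prj ω h g h′ = cong (_ ,_) (r-comp h g h′ (proj₂ ω))

  ∈↑-base : ∀ (A : TSet) {t} → proj₂ A t → (proj₁ A , t) ∈↑ A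
  ∈↑-base (_ , D) {t} d = (λ x → x) , subst D (sym (r-id (λ x → x) t)) d

  ∈↑-prj : ∀ ω {Ψ} (h : Ψ ⊆ lev ω) {Θ} (D : Pred (S Θ) 0ℓ) → Θ ⊆ Ψ →
           ω ∈↑ (Θ , D) ⇔ prj ω h ∈↑ (Θ , D)
  ∈↑-prj (Φ , s) h D Θ⊆Ψ = mk⇔
    (λ (g , d) → Θ⊆Ψ , subst D (sym (r-comp h Θ⊆Ψ g s)) d)
    (λ (g , d) → h ∘ g , subst D (r-comp h g (h ∘ g) s) d)

module HMSProperties {At I : Set} (M : HMS At I) where
  open HMS M
  open LatticeProperties lattice

  Πlev : I → Ω → Sub At
  Πlev i ω = proj₁ (Π i ω)

  Πlev-prj-⊆ : ∀ i ω {Ψ} (h : Ψ ⊆ lev ω) → Πlev i (prj ω h) ⊆ Πlev i ω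
  Πlev-prj-⊆ i ω h with t , t∈Π ← Π-ne i ω = proj₁ (PPI i ω h (Πlev i ω , t) (∈↑-base (Π i ω) t∈Π))

  ⊆Πlev-prj : ∀ i ω {Υ} (h : Υ ⊆ Πlev i ω) → Υ ⊆ Πlev i (prj ω (Conf i ω ∘ h))
  ⊆Πlev-prj i ω {Υ} h {x} x∈Υ with t , t∈Π ← Π-ne i ω =
    subst (λ Z → Z x) (proj₁ (proj₁ (PPK i ω h (Υ , r h t)) (refl , t , t∈Π , refl))) x∈Υ

  -- Υ := Πlev ω ∩ Ψ is the awareness level at ω_Υ = (ω_Ψ)_Υ, and awareness shrinks under projection.
  Πlev-prj-⊇ : ∀ i ω {Ψ} (h : Ψ ⊆ lev ω) → Πlev i ω ∩ Ψ ⊆ Πlev i (prj ω h)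
  Πlev-prj-⊇ i ω h {x} x∈Υ =
    Πlev-prj-⊆ i (prj ω h) proj₂ (subst (λ ω′ → Πlev i ω′ x) ω_Υ≡ (⊆Πlev-prj i ω proj₁ x∈Υ))
    where
    ω_Υ≡ : prj ω (Conf i ω ∘ proj₁) ≡ prj (prj ω h) proj₂
    ω_Υ≡ = sym (prj-prj ω h proj₂ (Conf i ω ∘ proj₁))

  Π⊆Λ↾ : ∀ i ω {t} → proj₂ (Π i ω) t → ∃ λ u → Λ i ω u × r (Conf i ω) u ≡ t
  Π⊆Λ↾ i ω {t} t∈Π
    with proj₁ (ImplMeas i ω (Πlev i ω , t) (refl , t∈Π) (Πlev i ω , t)) (refl , Λ-Refl i (Πlev i ω , t))
  ... | refl , u , u∈Λ , eq = u , u∈Λ , eq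

  Λ↾⊆Π : ∀ i ω {u} → Λ i ω u → proj₂ (Π i ω) (r (Conf i ω) u)
  Λ↾⊆Π i ω {u} u∈Λ =
    let g , g∈Π = GenRefl i (lev ω , u)
        e , e∈Π = proj₁ (ExplMeas i ω u u∈Λ (Πlev i (lev ω , u) , r g u)) (refl , g∈Π)
    in subst (proj₂ (Π i ω)) (subst-r e g (Conf i ω) u) e∈Π

  ⊨⇒Atoms⊆lev : ∀ φ ω → ω ⊨ φ → Atoms φ ⊆ lev ω
  k⇒a : ∀ {i} φ ω → ω ⊨ k i φ → ω ⊨ a i φ

  ⊨⇒Atoms⊆lev ⊤' ω _ ()
  ⊨⇒Atoms⊆lev (atom p) ω = proj₁
  ⊨⇒Atoms⊆lev (¬' φ) ω = proj₁
  ⊨⇒Atoms⊆lev (φ ∧' ψ) ω (φ✓ , ψ✓) (inj₁ x) = ⊨⇒Atoms⊆lev φ ω φ✓ x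
  ⊨⇒Atoms⊆lev (φ ∧' ψ) ω (φ✓ , ψ✓) (inj₂ x) = ⊨⇒Atoms⊆lev ψ ω ψ✓ x
  ⊨⇒Atoms⊆lev (ℓ i φ) ω H = ⊨⇒Atoms⊆lev φ ω (H (proj₂ ω) (Λ-Refl i ω))
  ⊨⇒Atoms⊆lev (a i φ) ω B = Conf i ω ∘ B
  ⊨⇒Atoms⊆lev (k i φ) ω H = Conf i ω ∘ k⇒a φ ω H

  k⇒a {i} φ ω H = let t , t∈Π = Π-ne i ω in ⊨⇒Atoms⊆lev φ (Πlev i ω , t) (H t t∈Π)

  PrjInvariant : Form At I → Set₁
  PrjInvariant φ = ∀ ω {Ψ} (h : Ψ ⊆ lev ω) → Atoms φ ⊆ Ψ → ω ⊨ φ ⇔ prj ω h ⊨ φ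

  ℓ-prj : ∀ i φ → PrjInvariant φ → PrjInvariant (ℓ i φ)
  ℓ-prj i φ inv ω {Ψ} h A = mk⇔ down up
    where
    down : ω ⊨ ℓ i φ → prj ω h ⊨ ℓ i φ
    down H t t∈Λ with proj₂ (PPIK i ω h (Ψ , t)) (refl , t∈Λ)
    ... | refl , u , u∈Λ , refl = to (inv (lev ω , u) h A) (H u u∈Λ)
    up : prj ω h ⊨ ℓ i φ → ω ⊨ ℓ i φ
    up H u u∈Λ with proj₁ (PPIK i ω h (Ψ , r h u)) (refl , u , u∈Λ , refl)
    ... | refl , t∈Λ = from (inv (lev ω , u) h A) (H _ t∈Λ)

  a-prj : ∀ i φ → PrjInvariant (a i φ)
  a-prj i φ ω h A = mk⇔ down up
    where
    down : Atoms φ ⊆ Πlev i ω → Atoms φ ⊆ Πlev i (prj ω h)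
    down B x∈φ = Πlev-prj-⊇ i ω h (B x∈φ , A x∈φ)
    up : Atoms φ ⊆ Πlev i (prj ω h) → Atoms φ ⊆ Πlev i ω
    up B = Πlev-prj-⊆ i ω h ∘ B

  k⇔ℓ×a : ∀ φ → PrjInvariant φ → ∀ i ω → ω ⊨ k i φ ⇔ (ω ⊨ ℓ i φ × ω ⊨ a i φ)
  k⇔ℓ×a φ inv i ω = mk⇔ ℓa-from-k k-from-ℓa
    where
    ℓa-from-k : ω ⊨ k i φ → ω ⊨ ℓ i φ × ω ⊨ a i φ
    ℓa-from-k H = ℓ-from-k , k⇒a φ ω H
      where
      ℓ-from-k : ω ⊨ ℓ i φ
      ℓ-from-k u u∈Λ = from (inv (lev ω , u) (Conf i ω) (k⇒a φ ω H)) (H _ (Λ↾⊆Π i ω u∈Λ))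
    k-from-ℓa : ω ⊨ ℓ i φ × ω ⊨ a i φ → ω ⊨ k i φ
    k-from-ℓa (H , B) t t∈Π with Π⊆Λ↾ i ω t∈Π
    ... | u , u∈Λ , refl = to (inv (lev ω , u) (Conf i ω) B) (H u u∈Λ)

  k-prj : ∀ i φ → PrjInvariant φ → PrjInvariant (k i φ)
  k-prj i φ inv ω h A =
    ⇔-sym (k⇔ℓ×a φ inv i (prj ω h))
      ⇔-∘ ((ℓ-prj i φ inv ω h A ×-⇔ a-prj i φ ω h A) ⇔-∘ k⇔ℓ×a φ inv i ω)

  ⊨-prj : ∀ φ → PrjInvariant φ
  ⊨-prj ⊤' ω h A = ⇔-id _
  ⊨-prj (atom p) ω h A = ∈↑-prj ω h (v p) A
  ⊨-prj (¬' φ) ω h A = ∈↑-prj ω h (λ t → ¬ ((Atoms φ , t) ⊨ φ)) A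
  ⊨-prj (φ ∧' ψ) ω h A = ⊨-prj φ ω h (A ∘ inj₁) ×-⇔ ⊨-prj ψ ω h (A ∘ inj₂)
  ⊨-prj (ℓ i φ) = ℓ-prj i φ (⊨-prj φ)
  ⊨-prj (a i φ) = a-prj i φ
  ⊨-prj (k i φ) = k-prj i φ (⊨-prj φ)

module FHCorrespondence {At I : Set} (M : HMS At I) where
  open HMS M
  open HMSProperties M
  open FHModel (FH M) using (_⊩_)

  ℓ-cong : ∀ {φ} i → (∀ w → (U , w) ⊨ φ ⇔ w ⊩ φ) → ∀ w → (U , w) ⊨ ℓ i φ ⇔ w ⊩ ℓ i φ
  ℓ-cong i φ⇔ w = mk⇔ (λ H w′ l → to (φ⇔ w′) (H w′ l)) (λ H w′ l → from (φ⇔ w′) (H w′ l))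

  ⊨⇔⊩ : ∀ φ (w : S U) → (U , w) ⊨ φ ⇔ w ⊩ φ
  ⊨⇔⊩ ⊤' w = ⇔-id _
  ⊨⇔⊩ (atom p) w = ⇔-id _
  ⊨⇔⊩ (¬' φ) w = mk⇔ to¬ from¬
    where
    prj⇔ : (g : Atoms φ ⊆ U) → prj (U , w) g ⊨ φ ⇔ w ⊩ φ
    prj⇔ g = ⊨⇔⊩ φ w ⇔-∘ ⇔-sym (⊨-prj φ (U , w) g (λ x → x))
    to¬ : (U , w) ⊨ (¬' φ) → w ⊩ (¬' φ)
    to¬ (g , ¬φ) = ¬φ ∘ from (prj⇔ g)
    from¬ : w ⊩ (¬' φ) → (U , w) ⊨ (¬' φ)
    from¬ ¬φ = (λ _ → tt) , ¬φ ∘ to (prj⇔ _)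
  ⊨⇔⊩ (φ ∧' ψ) w = ⊨⇔⊩ φ w ×-⇔ ⊨⇔⊩ ψ w
  ⊨⇔⊩ (ℓ i φ) = ℓ-cong i (⊨⇔⊩ φ)
  ⊨⇔⊩ (a i φ) w = ⇔-id _
  ⊨⇔⊩ (k i φ) w = (ℓ-cong i (⊨⇔⊩ φ) w ×-⇔ ⇔-id _) ⇔-∘ k⇔ℓ×a φ (⊨-prj φ) i (U , w)

proposition11 : (At I : Set) → At → I → (M : HMS At I) →
                ∀ (φ : Form At I) (ω : Lattice.S (HMS.lattice M) U) →
                (HMS._⊨_ M (U , ω) φ) ⇔ (FHModel._⊩_ (FH M) ω φ)
proposition11 _ _ _ _ M = FHCorrespondence.⊨⇔⊩ M
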